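{- Let $n$ be a positive integer. Let $$\mathcal{A}_n'=\{(0,S_1,\dots,S_{2n})\in\mathbb{Z}^{2n+1}:\ |S_i-S_{i-1}|=1\ (1\le i\le 2n),\ S_0=0,\ S_1>0,\ S_{2n}=0\},$$ $$\mathcal{B}_n'=\{(0,S_1,\dots,S_{2n})\in\mathbb{Z}^{2n+1}:\ |S_i-S_{i-1}|=1\ (1\le i\le 2n),\ S_0=0,\ S_i>0 \text{ for all } 1\le i\le 2n\}.$$ Then the map $\Phi_1:\mathcal{A}_n'\to\mathcal{B}_n'$ defined below is a well-defined bijection between $\mathcal{A}_n'$ and $\mathcal{B}_n'$. Definition of $\Phi_1$: for $(0,S_1,\dots,S_{2n})\in\mathcal{A}_n'$, let $M=\max\{S_1,\dots,S_{2n}\}$, let $a_M=\min\{1\le i\le 2n: S_i=M\}$, $b_0=0$, and for $k=M-1,M-2,\dots,1$ define inductively $$a_k=\min\{1\le i\le a_{k+1}: S_i=k\},\qquad b_k=\max\{1\le i\le a_{k+1}: S_i=k\}.$$ (One has $1=a_1\le b_1<a_2\le b_2<\dots<a_M$ and $a_i=b_{i-1}+1$.) For $\ell=1,\dots,2n$ set $$T_\ell=\begin{cases}2m-S_\ell & \text{if } a_m\le \ell\le b_m,\ m\in\{1,\dots,M-1\},\\ 2M-S_\ell & \text{if } \ell\ge a_M,\end{cases}$$ and $\Phi_1((0,S_1,\dots,S_{2n}))=(0,T_1,\dots,T_{2n})$.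
   Context: Sequences $(0,S_1,\dots,S_{2n})$ with $S_0=0$ and $|S_i-S_{i-1}|=1$ are the $2n$-step simple random walk paths on $\mathbb{Z}$ starting at the origin. -}

module Defs where

open import Data.Nat as ℕ using (ℕ; zero; suc; _∸_)
open import Data.Integer as ℤ using (ℤ; +_; _-_; _*_; _⊔_; _<_; ∣_∣)
import Data.Integer.Properties as ℤP
open import Data.Bool using (Bool; true; false; if_then_else_; _∧_)
open import Data.Maybe using (Maybe; just; nothing; fromMaybe)
open import Data.Vec using (Vec; []; _∷_; tabulate)
open import Data.Fin using (Fin; toℕ)
open import Data.Product using (_×_)
open import Relation.Nullary using (does)
open import Relation.Binary.PropositionalEquality using (_≡_)

Path : ℕ → Set
Path n = Vec ℤ (suc (2 ℕ.* n))

-- S_i (index i ; out-of-range indices give 0, never used on valid inputs)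
at : ∀ {m} → Vec ℤ m → ℕ → ℤ
at []       _       = + 0
at (x ∷ xs) zero    = x
at (x ∷ xs) (suc i) = at xs i

Steps : (n : ℕ) → Path n → Set
Steps n S = ∀ i → i ℕ.< 2 ℕ.* n → ∣ at S (suc i) - at S i ∣ ≡ 1

A′ : (n : ℕ) → Path n → Set
A′ n S = Steps n S × at S 0 ≡ + 0 × + 0 < at S 1 × at S (2 ℕ.* n) ≡ + 0

B′ : (n : ℕ) → Path n → Set
B′ n S = Steps n S × at S 0 ≡ + 0 ×
         (∀ i → 1 ℕ.≤ i → i ℕ.≤ 2 ℕ.* n → + 0 < at S i)

maxUpTo : (ℕ → ℤ) → ℕ → ℤ
maxUpTo f zero    = f 1
maxUpTo f (suc N) = maxUpTo f N ⊔ f (suc N)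

findFirst : (ℕ → Bool) → ℕ → Maybe ℕ
findFirst p zero    = nothing
findFirst p (suc B) with findFirst p B
... | just i  = just i
... | nothing = if p (suc B) then just (suc B) else nothing

findLast : (ℕ → Bool) → ℕ → Maybe ℕ
findLast p zero    = nothing
findLast p (suc B) = if p (suc B) then just (suc B) else findLast p B

_==_ : ℤ → ℤ → Bool
x == y = does (x ℤ.≟ y)

_≤ᵇ_ : ℕ → ℕ → Bool
m ≤ᵇ k = does (m ℕ.≤? k)

module Phi (n : ℕ) (S : Path n) where
  s : ℕ → ℤ
  s = at S

  M : ℤ
  M = maxUpTo s (2 ℕ.* n)

  Mn : ℕ
  Mn = ∣ M ∣

  -- aAux d = a_{M-d}  (0 ≤ d ≤ M-1)
  aAux : ℕ → ℕ
  aAux zero    = fromMaybe 0 (findFirst (λ i → s i == M) (2 ℕ.* n))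
  aAux (suc d) = fromMaybe 0 (findFirst (λ i → s i == (M - + suc d)) (aAux d))

  -- bAux d = b_{M-d-1}
  bAux : ℕ → ℕ
  bAux d = fromMaybe 0 (findLast (λ i → s i == (M - + suc d)) (aAux d))

  a : ℕ → ℕ
  a k = aAux (Mn ∸ k)

  b : ℕ → ℕ
  b k = bAux (Mn ∸ suc k)

  T : ℕ → ℤ
  T zero = + 0
  T (suc l) with a Mn ≤ᵇ suc l
  ... | true  = + 2 * M - s (suc l)
  ... | false with findFirst (λ m → (a m ≤ᵇ suc l) ∧ (suc l ≤ᵇ b m)) (Mn ∸ 1)
  ...   | just m  = + 2 * + m - s (suc l)
  ...   | nothing = s (suc l)   -- unreachable on A'_n

Φ₁ : (n : ℕ) → Path n → Path n
Φ₁ n S = tabulate (λ (i : Fin (suc (2 ℕ.* n))) → Phi.T n S (toℕ i))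

module Submission where

-- The map Φ₁ is the Pitman transform  T_ℓ = 2 R_ℓ − S_ℓ,  where
-- R_ℓ = max {S_1, …, S_ℓ} is the running maximum of the path.
--
-- Indeed, for an index ℓ in the block [a_m, b_m] the running maximum equals m
-- (a_m is the first visit of level m, b_m + 1 = a_{m+1} the first visit of m+1),
-- and for ℓ ≥ a_M it equals M.

open import Defs

open import Data.Nat as ℕ using (ℕ; zero; suc; _∸_; z≤n; s≤s; _≤_; _<_)
import Data.Nat.Properties as ℕP
open import Data.Integer as ℤ using (ℤ; +_; -[1+_]; _+_; _-_; _*_; _⊔_; _⊓_; ∣_∣; +≤+; +<+)
import Data.Integer.Properties as ℤP
open import Data.Integer.Tactic.RingSolver using (solve-∀)
open import Data.Bool using (Bool; true; false; _∧_)
open import Data.Bool.Properties using (∧-zeroʳ)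
open import Data.Maybe using (just; nothing; fromMaybe)
open import Data.Vec using (Vec; []; _∷_; tabulate)
open import Data.Fin using (toℕ)
open import Data.Sum using (_⊎_; inj₁; inj₂)
open import Data.Product using (_×_; _,_; Σ; ∃; proj₁; proj₂)
open import Data.Empty using (⊥-elim)
open import Relation.Nullary using (yes; no; ¬_; Dec)
open import Relation.Nullary.Decidable using (dec-true; dec-false)
open import Relation.Binary.PropositionalEquality


Step : ℤ → ℤ → Set
Step x y = y ≡ + 1 + x ⊎ x ≡ + 1 + y

absolute-one : ∀ z → ∣ z ∣ ≡ 1 → z ≡ + 1 ⊎ z ≡ -[1+ 0 ]
absolute-one (+ .1)   refl = inj₁ refl
absolute-one -[1+ 0 ] refl = inj₂ refl

unit⇒Step : ∀ x y → ∣ y - x ∣ ≡ 1 → Step x y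
unit⇒Step x y h with absolute-one (y - x) h
... | inj₁ e = inj₁ (trans (sym (up x y)) (cong (_+ x) e))
  where up : ∀ x y → (y - x) + x ≡ y
        up = solve-∀
... | inj₂ e = inj₂ (trans (down x y) (cong (λ z → ℤ.- z + y) e))
  where down : ∀ x y → x ≡ ℤ.- (y - x) + y
        down = solve-∀

Step⇒unit : ∀ x y → Step x y → ∣ y - x ∣ ≡ 1
Step⇒unit x .(+ 1 + x) (inj₁ refl) = cong ∣_∣ (up x)
  where up : ∀ x → (+ 1 + x) - x ≡ + 1
        up = solve-∀
Step⇒unit .(+ 1 + y) y (inj₂ refl) = cong ∣_∣ (down y)
  where down : ∀ y → y - (+ 1 + y) ≡ ℤ.- + 1
        down = solve-∀

Step-sym : ∀ {x y} → Step x y → Step y x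
Step-sym (inj₁ e) = inj₂ e
Step-sym (inj₂ e) = inj₁ e

x<1+x : ∀ x → x ℤ.< + 1 + x
x<1+x x = ℤP.suc[i]≤j⇒i<j ℤP.≤-refl

x≤1+x : ∀ x → x ℤ.≤ + 1 + x
x≤1+x x = ℤP.<⇒≤ (x<1+x x)

<1+⇒≤ : ∀ {x y} → x ℤ.< + 1 + y → x ℤ.≤ y
<1+⇒≤ {x} {y} h = subst (x ℤ.≤_) (ℤP.pred-suc y) (ℤP.i<j⇒i≤pred[j] h)

1+-injective : ∀ {x y} → + 1 + x ≡ + 1 + y → x ≡ y
1+-injective {x} {y} e = trans (sym (ℤP.pred-suc x)) (trans (cong ℤ.pred e) (ℤP.pred-suc y))

2r-r≡r : ∀ r → + 2 * r - r ≡ r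
2r-r≡r = solve-∀

reflect-above : ∀ {s r} → s ℤ.≤ r → r ℤ.≤ + 2 * r - s
reflect-above {s} {r} le = ℤP.0≤i-j⇒j≤i (subst (ℤ.0ℤ ℤ.≤_) (eq r s) (ℤP.i≤j⇒0≤j-i le))
  where eq : ∀ r s → r - s ≡ (+ 2 * r - s) - r
        eq = solve-∀

reflect-below : ∀ {q t} → q ℤ.≤ t → + 2 * q - t ℤ.≤ q
reflect-below {q} {t} le = ℤP.0≤i-j⇒j≤i (subst (ℤ.0ℤ ℤ.≤_) (eq q t) (ℤP.i≤j⇒0≤j-i le))
  where eq : ∀ q t → t - q ≡ q - (+ 2 * q - t)
        eq = solve-∀

maximum-step : ∀ {s r s′} → s ℤ.≤ r → Step s s′ →
  s′ ℤ.≤ r ⊎ (s ≡ r × s′ ≡ + 1 + r)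
maximum-step {s} {r} {s′} s≤r st with s′ ℤP.≤? r
... | yes s′≤r = inj₁ s′≤r
... | no s′≰r with st
...   | inj₁ e = inj₂ (s≡r , trans e (cong (λ z → + 1 + z) s≡r))
  where s≡r : s ≡ r
        s≡r = ℤP.≤-antisym s≤r (<1+⇒≤ (subst (r ℤ.<_) e (ℤP.≰⇒> s′≰r)))
...   | inj₂ e = ⊥-elim (ℤP.<-irrefl refl
          (ℤP.<-≤-trans (ℤP.<-trans (ℤP.≰⇒> s′≰r) (x<1+x s′)) (subst (ℤ._≤ r) e s≤r)))

pitman-step : ∀ {s r s′} → s ℤ.≤ r → Step s s′ →
  ∣ (+ 2 * (r ⊔ s′) - s′) - (+ 2 * r - s) ∣ ≡ 1
pitman-step {s} {r} {s′} s≤r st with maximum-step s≤r st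
... | inj₁ s′≤r rewrite ℤP.i≥j⇒i⊔j≡i s′≤r =
  trans (cong ∣_∣ (eq r s s′)) (Step⇒unit s′ s (Step-sym st))
  where eq : ∀ r s s′ → (+ 2 * r - s′) - (+ 2 * r - s) ≡ s - s′
        eq = solve-∀
... | inj₂ (refl , refl) rewrite ℤP.i≤j⇒i⊔j≡j (x≤1+x r) = cong ∣_∣ (eq r)
  where eq : ∀ r → (+ 2 * (+ 1 + r) - (+ 1 + r)) - (+ 2 * r - r) ≡ + 1
        eq = solve-∀

-- The future of the transform never goes below the current maximum, and
-- meets it: the running maximum is recovered by a backward running minimum.
pitman-future-min : ∀ {s r s′} → s ℤ.≤ r → Step s s′ →
  (+ 2 * r - s) ⊓ (r ⊔ s′) ≡ r
pitman-future-min {s} {r} {s′} s≤r st with maximum-step s≤r st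
... | inj₁ s′≤r rewrite ℤP.i≥j⇒i⊔j≡i s′≤r = ℤP.i≥j⇒i⊓j≡j (reflect-above s≤r)
... | inj₂ (refl , refl) rewrite ℤP.i≤j⇒i⊔j≡j (x≤1+x r) | 2r-r≡r r =
  ℤP.i≤j⇒i⊓j≡i (x≤1+x r)

minimum-step : ∀ {q t q′ t′} → q ≡ t ⊓ q′ → q′ ℤ.≤ t′ → Step t t′ →
  q ≡ q′ ⊎ (q ≡ t × q′ ≡ + 1 + t × t′ ≡ + 1 + t)
minimum-step {q} {t} {q′} {t′} q≡ q′≤t′ st with q′ ℤP.≤? t
... | yes q′≤t = inj₁ (trans q≡ (ℤP.i≥j⇒i⊓j≡j q′≤t))
... | no q′≰t with st
...   | inj₁ e = inj₂ (trans q≡ (ℤP.i≤j⇒i⊓j≡i (ℤP.<⇒≤ t<q′)) , q′≡ , e)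
  where t<q′ : t ℤ.< q′
        t<q′ = ℤP.≰⇒> q′≰t
        q′≡ : q′ ≡ + 1 + t
        q′≡ = ℤP.≤-antisym (subst (q′ ℤ.≤_) e q′≤t′) (ℤP.i<j⇒suc[i]≤j t<q′)
...   | inj₂ e = ⊥-elim (ℤP.<-asym
          (subst (ℤ._< t′) e (ℤP.<-≤-trans (ℤP.≰⇒> q′≰t) q′≤t′)) (x<1+x t′))

inverse-step : ∀ {q t q′ t′} → q ≡ t ⊓ q′ → q′ ℤ.≤ t′ → Step t t′ →
  ∣ (+ 2 * q′ - t′) - (+ 2 * q - t) ∣ ≡ 1
inverse-step q≡ q′≤t′ st with minimum-step q≡ q′≤t′ st
inverse-step {q} {t} {q′} {t′} q≡ q′≤t′ st | inj₁ refl =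
  trans (cong ∣_∣ (eq q t t′)) (Step⇒unit t′ t (Step-sym st))
  where eq : ∀ q t t′ → (+ 2 * q - t′) - (+ 2 * q - t) ≡ t - t′
        eq = solve-∀
inverse-step {t = t} q≡ q′≤t′ st | inj₂ (refl , refl , refl) = cong ∣_∣ (eq t)
  where eq : ∀ t → (+ 2 * (+ 1 + t) - (+ 1 + t)) - (+ 2 * t - t) ≡ + 1
        eq = solve-∀

inverse-running-max : ∀ {q t q′ t′} → q ≡ t ⊓ q′ → q′ ℤ.≤ t′ → Step t t′ →
  q ⊔ (+ 2 * q′ - t′) ≡ q′
inverse-running-max q≡ q′≤t′ st with minimum-step q≡ q′≤t′ st
... | inj₁ refl = ℤP.i≥j⇒i⊔j≡i (reflect-below q′≤t′)
inverse-running-max {t = t} q≡ q′≤t′ st | inj₂ (refl , refl , refl)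
  rewrite 2r-r≡r (+ 1 + t) = ℤP.i≤j⇒i⊔j≡j (x≤1+x t)

==-true : ∀ {x y} → x ≡ y → (x == y) ≡ true
==-true {x} {y} = dec-true (x ℤ.≟ y)

==-false : ∀ {x y} → ¬ x ≡ y → (x == y) ≡ false
==-false {x} {y} = dec-false (x ℤ.≟ y)

≤ᵇ-true : ∀ {x y} → x ≤ y → (x ≤ᵇ y) ≡ true
≤ᵇ-true {x} {y} = dec-true (x ℕ.≤? y)

≤ᵇ-false : ∀ {x y} → ¬ x ≤ y → (x ≤ᵇ y) ≡ false
≤ᵇ-false {x} {y} = dec-false (x ℕ.≤? y)

findFirst-none : ∀ p B → (∀ i → 1 ≤ i → i ≤ B → p i ≡ false) → findFirst p B ≡ nothing
findFirst-none p zero    none = refl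
findFirst-none p (suc B) none
  rewrite findFirst-none p B (λ i 1≤i i≤B → none i 1≤i (ℕP.m≤n⇒m≤1+n i≤B))
        | none (suc B) (s≤s z≤n) ℕP.≤-refl = refl

findFirst-least : ∀ p B x → p x ≡ true → 1 ≤ x → x ≤ B →
  (∀ i → 1 ≤ i → i < x → p i ≡ false) → findFirst p B ≡ just x
findFirst-least p zero    zero px () z≤n below
findFirst-least p (suc B) x px 1≤x x≤B below with ℕP.m≤n⇒m<n∨m≡n x≤B
... | inj₁ (s≤s x≤B′) rewrite findFirst-least p B x px 1≤x x≤B′ below = refl
... | inj₂ refl rewrite findFirst-none p B (λ i 1≤i i≤B → below i 1≤i (s≤s i≤B)) | px = refl

findLast-top : ∀ p B → p (suc B) ≡ true → findLast p (suc B) ≡ just (suc B)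
findLast-top p B e rewrite e = refl

findLast-skip : ∀ p B → p (suc B) ≡ false → findLast p (suc B) ≡ findLast p B
findLast-skip p B e rewrite e = refl

Least : (ℕ → Set) → ℕ → ℕ → Set
Least P N x = x ≤ N × P x × (∀ y → y < x → ¬ P y)

least-or-none : (P : ℕ → Set) → (∀ k → Dec (P k)) → ∀ N →
  Σ ℕ (Least P N) ⊎ (∀ y → y ≤ N → ¬ P y)
least-or-none P P? zero with P? 0
... | yes p = inj₁ (0 , z≤n , p , λ y ())
... | no ¬p = inj₂ (λ { .zero z≤n → ¬p })
least-or-none P P? (suc N) with least-or-none P P? N
... | inj₁ (x , x≤N , px , below) = inj₁ (x , ℕP.m≤n⇒m≤1+n x≤N , px , below)
... | inj₂ none with P? (suc N)
...   | yes p = inj₁ (suc N , ℕP.≤-refl , p , λ y y<1+N → none y (ℕP.≤-pred y<1+N))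
...   | no ¬p = inj₂ none′
  where none′ : ∀ y → y ≤ suc N → ¬ P y
        none′ y y≤ with ℕP.m≤n⇒m<n∨m≡n y≤
        ... | inj₁ y<1+N = none y (ℕP.≤-pred y<1+N)
        ... | inj₂ refl  = ¬p

least : (P : ℕ → Set) → (∀ k → Dec (P k)) → ∀ N → P N → Σ ℕ (Least P N)
least P P? N pN with least-or-none P P? N
... | inj₁ found = found
... | inj₂ none  = ⊥-elim (none N ℕP.≤-refl pN)

at-tabulate : ∀ m (g : ℕ → ℤ) i → i < m → at (tabulate {n = m} (λ j → g (toℕ j))) i ≡ g i
at-tabulate (suc m) g zero    _       = refl
at-tabulate (suc m) g (suc i) (s≤s h) = at-tabulate m (λ j → g (suc j)) i h

at-ext : ∀ {m} (u v : Vec ℤ m) → (∀ i → i < m → at u i ≡ at v i) → u ≡ v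
at-ext []      []      _  = refl
at-ext (x ∷ u) (y ∷ v) eq = cong₂ _∷_ (eq 0 (s≤s z≤n)) (at-ext u v (λ i h → eq (suc i) (s≤s h)))

-- The running maximum  R l = max {f 1, …, f (l ⊔ 1)}  of a sequence.
module RunningMax (f : ℕ → ℤ) where
  R : ℕ → ℤ
  R = maxUpTo f

  R-step : ∀ l → R l ℤ.≤ R (suc l)
  R-step l = ℤP.i≤i⊔j (R l) (f (suc l))

  R-mono : ∀ {l l′} → l ≤ l′ → R l ℤ.≤ R l′
  R-mono {l′ = zero}   z≤n = ℤP.≤-refl
  R-mono {l′ = suc l′} h with ℕP.m≤n⇒m<n∨m≡n h
  ... | inj₁ (s≤s h′) = ℤP.≤-trans (R-mono h′) (R-step l′)
  ... | inj₂ refl     = ℤP.≤-refl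

  R-upper : ∀ i l → 1 ≤ i → i ≤ l → f i ℤ.≤ R l
  R-upper zero    zero    () z≤n
  R-upper i (suc l) 1≤i i≤l with ℕP.m≤n⇒m<n∨m≡n i≤l
  ... | inj₁ (s≤s h) = ℤP.≤-trans (R-upper i l 1≤i h) (R-step l)
  ... | inj₂ refl    = ℤP.i≤j⊔i (R l) (f (suc l))

  R-below : ∀ k l → (∀ i → 1 ≤ i → i ≤ suc l → f i ℤ.< k) → R l ℤ.< k
  R-below k zero    bound = bound 1 ℕP.≤-refl ℕP.≤-refl
  R-below k (suc l) bound with ℤP.⊔-sel (R l) (f (suc l))
  ... | inj₁ e rewrite e = R-below k l (λ i 1≤i i≤ → bound i 1≤i (ℕP.m≤n⇒m≤1+n i≤))
  ... | inj₂ e rewrite e = bound (suc l) (s≤s z≤n) (ℕP.n≤1+n _)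

  R-below′ : ∀ k l → (∀ i → 1 ≤ i → i ≤ suc l → f i ℤ.< k) → R (suc l) ℤ.< k
  R-below′ k l bound with ℤP.⊔-sel (R l) (f (suc l))
  ... | inj₁ e rewrite e = R-below k l bound
  ... | inj₂ e rewrite e = bound (suc l) (s≤s z≤n) ℕP.≤-refl

windowMin : (ℕ → ℤ) → ℕ → ℕ → ℤ
windowMin g l zero    = g l
windowMin g l (suc d) = g l ⊓ windowMin g (suc l) d

windowMin-glb : ∀ g c l d → (∀ j → l ≤ j → j ≤ l ℕ.+ d → c ℤ.≤ g j) → c ℤ.≤ windowMin g l d
windowMin-glb g c l zero    lower = lower l ℕP.≤-refl (ℕP.m≤m+n l 0)
windowMin-glb g c l (suc d) lower = ℤP.⊓-glb (lower l ℕP.≤-refl (ℕP.m≤m+n l _))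
  (windowMin-glb g c (suc l) d
    (λ j l<j j≤ → lower j (ℕP.<⇒≤ l<j) (subst (j ≤_) (sym (ℕP.+-suc l d)) j≤)))

+-∸ : ∀ m d → d ≤ m → + m - + d ≡ + (m ∸ d)
+-∸ m d d≤m = trans (ℤP.m-n≡m⊖n m d) (ℤP.⊖-≥ d≤m)

-- A (2n)-step path with S_0 = 0 < S_1: the hypotheses of A′ₙ except S_{2n} = 0.
-- For such a path, Φ₁ is the Pitman transform 2R − S and lands in B′ₙ.
module Walk (n : ℕ) (1≤n : 1 ≤ n) (S : Path n)
            (steps : Steps n S) (s0 : at S 0 ≡ + 0) (s1>0 : + 0 ℤ.< at S 1) where

  N : ℕ
  N = 2 ℕ.* n

  s : ℕ → ℤ
  s = at S

  open RunningMax s public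

  1≤N : 1 ≤ N
  1≤N = ℕP.≤-trans 1≤n (ℕP.m≤m+n n _)

  step : ∀ i → i < N → Step (s i) (s (suc i))
  step i i<N = unit⇒Step (s i) (s (suc i)) (steps i i<N)

  s1 : s 1 ≡ + 1
  s1 with step 0 1≤N
  ... | inj₁ e = trans e (cong (λ z → + 1 + z) s0)
  ... | inj₂ e = ⊥-elim (ℤP.<-asym s1>0
          (subst (s 1 ℤ.<_) (trans (sym e) s0) (x<1+x (s 1))))

  R≥1 : ∀ l → + 1 ℤ.≤ R l
  R≥1 l = subst (ℤ._≤ R l) s1 (R-mono {0} {l} z≤n)

  s≤R : ∀ l → s l ℤ.≤ R l
  s≤R zero    = subst₂ ℤ._≤_ (sym s0) (sym s1) (+≤+ z≤n)
  s≤R (suc l) = R-upper (suc l) (suc l) (s≤s z≤n) ℕP.≤-refl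

  M : ℤ
  M = R N

  Mn : ℕ
  Mn = ∣ M ∣

  +Mn≡M : + Mn ≡ M
  +Mn≡M = ℤP.0≤i⇒+∣i∣≡i (ℤP.≤-trans (+≤+ z≤n) (R≥1 N))

  1≤Mn : 1 ≤ Mn
  1≤Mn = ℤP.drop‿+≤+ (subst (+ 1 ℤ.≤_) (sym +Mn≡M) (R≥1 N))

  ≤Mn⇒≤M : ∀ {k} → k ≤ Mn → + k ℤ.≤ M
  ≤Mn⇒≤M k≤Mn = subst (_ ℤ.≤_) +Mn≡M (+≤+ k≤Mn)

  -- By unit steps, the running maximum can only increase by passing through
  -- each level: if R y < k ≤ R (y + 1) then S_{y+1} = k.
  crossing : ∀ y k → y < N → R y ℤ.< + k → + k ℤ.≤ R (suc y) → s (suc y) ≡ + k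
  crossing y k y<N Ry<k k≤R′ = ℤP.≤-antisym s′≤k k≤s′
    where
      k≤s′ : + k ℤ.≤ s (suc y)
      k≤s′ with ℤP.⊔-sel (R y) (s (suc y))
      ... | inj₁ e = ⊥-elim (ℤP.<⇒≱ Ry<k (subst (+ k ℤ.≤_) e k≤R′))
      ... | inj₂ e = subst (+ k ℤ.≤_) e k≤R′
      s′≤k : s (suc y) ℤ.≤ + k
      s′≤k with step y y<N
      ... | inj₁ e = subst (ℤ._≤ + k) (sym e)
              (ℤP.≤-trans (ℤP.suc-mono (s≤R y)) (ℤP.i<j⇒suc[i]≤j Ry<k))
      ... | inj₂ e = ℤP.≤-trans (subst (s (suc y) ℤ.≤_) (sym e) (x≤1+x (s (suc y))))
              (ℤP.≤-trans (s≤R y) (ℤP.<⇒≤ Ry<k))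

  FirstVisit : ℕ → ℕ → Set
  FirstVisit k x = 1 ≤ x × x ≤ N × s x ≡ + k × (∀ i → 1 ≤ i → i < x → s i ℤ.< + k)

  -- Every level 1 ≤ k ≤ M is visited: its first visit is the least y with k ≤ R y.
  first-visit : ∀ k → 1 ≤ k → + k ℤ.≤ M → Σ ℕ (FirstVisit k)
  first-visit k 1≤k k≤M with least (λ y → + k ℤ.≤ R y) (λ y → + k ℤ.≤? R y) N k≤M
  ... | zero , _ , k≤R0 , _ =
    1 , ℕP.≤-refl , 1≤N , trans s1 (cong +_ 1≡k) , λ i 1≤i i<1 → ⊥-elim (ℕP.<⇒≱ i<1 1≤i)
    where 1≡k : 1 ≡ k
          1≡k = ℕP.≤-antisym 1≤k (ℤP.drop‿+≤+ (subst (+ k ℤ.≤_) s1 k≤R0))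
  ... | suc y , y<N , k≤R , below = suc y , s≤s z≤n , y<N ,
    crossing y k y<N Ry<k k≤R , λ i 1≤i i≤y → ℤP.≤-<-trans (R-upper i y 1≤i (ℕP.≤-pred i≤y)) Ry<k
    where Ry<k : R y ℤ.< + k
          Ry<k = ℤP.≰⇒> (below y ℕP.≤-refl)

  module _ {k x : ℕ} (visit : FirstVisit k x) where
    visit-reached : ∀ {i} → x ≤ i → + k ℤ.≤ R i
    visit-reached {i} x≤i = subst (ℤ._≤ R i) (proj₁ (proj₂ (proj₂ visit)))
                              (R-upper x i (proj₁ visit) x≤i)

    visit-not-reached : ∀ {i} → 1 ≤ i → i < x → R i ℤ.< + k
    visit-not-reached {suc i} _ i<x =
      R-below′ (+ k) i (λ j 1≤j j≤ → proj₂ (proj₂ (proj₂ visit)) j 1≤j (ℕP.≤-<-trans j≤ i<x))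

    visit-first : ∀ {j} → 1 ≤ j → s j ≡ + k → x ≤ j
    visit-first {j} 1≤j sj≡k with x ℕ.≤? j
    ... | yes x≤j = x≤j
    ... | no x≰j  = ⊥-elim (ℤP.<-irrefl sj≡k (proj₂ (proj₂ (proj₂ visit)) j 1≤j (ℕP.≰⇒> x≰j)))

    reached⇒visited : ∀ {i} → 1 ≤ i → + k ℤ.≤ R i → x ≤ i
    reached⇒visited {i} 1≤i k≤R with x ℕ.≤? i
    ... | yes x≤i = x≤i
    ... | no x≰i  = ⊥-elim (ℤP.<⇒≱ (visit-not-reached 1≤i (ℕP.≰⇒> x≰i)) k≤R)

    unreached⇒unvisited : ∀ {i} → R i ℤ.< + k → i < x
    unreached⇒unvisited {i} R<k with x ℕ.≤? i
    ... | yes x≤i = ⊥-elim (ℤP.<⇒≱ R<k (visit-reached x≤i))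
    ... | no x≰i  = ℕP.≰⇒> x≰i

  visit-previous : ∀ {k y} → FirstVisit (suc k) y → 1 ≤ k →
    Σ ℕ λ y′ → y ≡ suc y′ × 1 ≤ y′ × s y′ ≡ + k
  visit-previous {k} {suc zero} (_ , _ , s1≡ , _) 1≤k =
    ⊥-elim (ℕP.<⇒≱ (s≤s 1≤k) (ℤP.drop‿+≤+ (ℤP.≤-reflexive (trans (sym s1≡) s1))))
  visit-previous {k} {suc (suc y)} (_ , y<N , sy≡ , below) 1≤k =
    suc y , refl , s≤s z≤n , ℤP.≤-antisym (<1+⇒≤ (below (suc y) (s≤s z≤n) ℕP.≤-refl)) k≤s
    where
      k≤s : + k ℤ.≤ s (suc y)
      k≤s with step (suc y) y<N
      ... | inj₁ e = ℤP.≤-reflexive (sym (1+-injective (trans (sym e) sy≡)))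
      ... | inj₂ e = ℤP.≤-trans (ℤP.<⇒≤ (x<1+x (+ k)))
                       (ℤP.≤-trans (ℤP.≤-reflexive (sym sy≡)) (subst (s (suc (suc y)) ℤ.≤_) (sym e) (x≤1+x (s (suc (suc y))))))

  visits-ordered : ∀ {k x y} → FirstVisit k x → FirstVisit (suc k) y → 1 ≤ k → x < y
  visits-ordered vk vk+1 1≤k with visit-previous vk+1 1≤k
  ... | y′ , refl , 1≤y′ , sy′≡k = s≤s (visit-first vk 1≤y′ sy′≡k)

  module P = Phi n S

  level-below-top : ∀ d → suc d ≤ Mn → M - + suc d ≡ + (Mn ∸ suc d)
  level-below-top d d<Mn = trans (cong (_- + suc d) (sym +Mn≡M)) (+-∸ Mn (suc d) d<Mn)

  first-visit-of : ∀ k → 1 ≤ k → k ≤ Mn → Σ ℕ (FirstVisit k)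
  first-visit-of k 1≤k k≤Mn = first-visit k 1≤k (≤Mn⇒≤M k≤Mn)

  -- a_{M−d} is the first visit of level M − d: the first visit of M is the
  -- first time the path equals M, and the first visit of M − d − 1 precedes
  -- that of M − d, so the bounded search for level M − d − 1 finds it.
  aAux-first-visit : ∀ d → suc d ≤ Mn → ∀ {x} → FirstVisit (Mn ∸ d) x → P.aAux d ≡ x
  aAux-first-visit zero _ {x} (1≤x , x≤N , sx≡ , below) =
    cong (fromMaybe 0) (findFirst-least _ N x (==-true (trans sx≡ +Mn≡M)) 1≤x x≤N
      (λ i 1≤i i<x → ==-false (λ si≡M → ℤP.<-irrefl (trans si≡M (sym +Mn≡M)) (below i 1≤i i<x))))
  aAux-first-visit (suc d) d<Mn {x} v@(1≤x , _ , sx≡ , below) =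
    trans (cong (λ B → fromMaybe 0 (findFirst level B)) (aAux-first-visit d d≤Mn (proj₂ next)))
          (cong (fromMaybe 0) (findFirst-least level y x (==-true (trans sx≡ (sym value)))
             1≤x (ℕP.<⇒≤ x<y) (λ i 1≤i i<x → ==-false (λ si≡ → ℤP.<-irrefl (trans si≡ value) (below i 1≤i i<x)))))
    where
      d≤Mn = ℕP.<⇒≤ d<Mn
      level : ℕ → Bool
      level i = s i == (M - + suc d)
      value : M - + suc d ≡ + (Mn ∸ suc d)
      value = level-below-top d d≤Mn
      next : Σ ℕ (FirstVisit (Mn ∸ d))
      next = first-visit-of (Mn ∸ d) (ℕP.m<n⇒0<n∸m d≤Mn) (ℕP.m∸n≤m Mn d)
      y = proj₁ next
      x<y : x < y
      x<y = visits-ordered v (subst (λ j → FirstVisit j y) (ℕP.+-∸-assoc 1 d≤Mn) (proj₂ next))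
              (ℕP.m<n⇒0<n∸m d<Mn)

  a≡first-visit : ∀ k → 1 ≤ k → k ≤ Mn → ∀ {x} → FirstVisit k x → P.a k ≡ x
  a≡first-visit k 1≤k k≤Mn {x} v = aAux-first-visit (Mn ∸ k) (ℕP.∸-monoʳ-< {Mn} {k} {0} 1≤k k≤Mn)
    (subst (λ j → FirstVisit j x) (sym (ℕP.m∸[m∸n]≡n k≤Mn)) v)

  b≡before-next-visit : ∀ k → 1 ≤ k → suc k ≤ Mn → ∀ {y} → FirstVisit (suc k) y → P.b k ≡ ℕ.pred y
  b≡before-next-visit k 1≤k k<Mn {y} v =
    trans (cong (λ B → fromMaybe 0 (findLast level B)) (a≡first-visit (suc k) (s≤s z≤n) k<Mn v))
          (last-before y v)
    where
      level : ℕ → Bool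
      level i = s i == (M - + suc (Mn ∸ suc k))
      value : M - + suc (Mn ∸ suc k) ≡ + k
      value = trans (level-below-top (Mn ∸ suc k) (ℕP.∸-monoʳ-< {Mn} {suc k} {0} (s≤s z≤n) k<Mn))
                (cong +_ (trans (cong (Mn ∸_) (sym (ℕP.+-∸-assoc 1 k<Mn))) (ℕP.m∸[m∸n]≡n (ℕP.<⇒≤ k<Mn))))
      last-before : ∀ y → FirstVisit (suc k) y → fromMaybe 0 (findLast level y) ≡ ℕ.pred y
      last-before y v with visit-previous v 1≤k
      last-before .(suc (suc y′)) v | suc y′ , refl , _ , sy′≡k
        rewrite findLast-skip level (suc y′)
                  (==-false (λ e → ℕP.1+n≢n (cong ∣_∣ (trans (sym (proj₁ (proj₂ (proj₂ v)))) (trans e value)))))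
              | findLast-top level y′ (==-true (trans sy′≡k (sym value))) = refl

  -- Strictly before a_M the running maximum
  -- m = R_L < M identifies the block [a_m, b_m] containing L, the first one
  -- found by the search in the definition of T; from a_M on, R_L = M.
  InBlock : ℕ → ℕ → Bool
  InBlock L m = (P.a m ≤ᵇ L) ∧ (L ≤ᵇ P.b m)

  in-own-block : ∀ L m → 1 ≤ L → 1 ≤ m → m < Mn → R L ≡ + m → InBlock L m ≡ true
  in-own-block L m 1≤L 1≤m m<Mn RL≡m =
    trans (cong₂ (λ a b → (a ≤ᵇ L) ∧ (L ≤ᵇ b)) (a≡first-visit m 1≤m (ℕP.<⇒≤ m<Mn) (proj₂ vm))
                                                (b≡before-next-visit m 1≤m m<Mn (proj₂ vm+1)))
          (cong₂ _∧_ (≤ᵇ-true (reached⇒visited (proj₂ vm) 1≤L (ℤP.≤-reflexive (sym RL≡m))))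
                     (≤ᵇ-true (ℕP.<⇒≤pred (unreached⇒unvisited (proj₂ vm+1) {L}
                                 (subst (ℤ._< + suc m) (sym RL≡m) (x<1+x (+ m)))))))
    where
      vm = first-visit-of m 1≤m (ℕP.<⇒≤ m<Mn)
      vm+1 = first-visit-of (suc m) (s≤s z≤n) m<Mn

  not-in-lower-block : ∀ L m m′ → 1 ≤ L → 1 ≤ m′ → m′ < m → m < Mn → R L ≡ + m →
    InBlock L m′ ≡ false
  not-in-lower-block L m m′ 1≤L 1≤m′ m′<m m<Mn RL≡m =
    trans (cong (λ b → (P.a m′ ≤ᵇ L) ∧ (L ≤ᵇ b)) (b≡before-next-visit m′ 1≤m′ m′<Mn (proj₂ vm′+1)))
          (trans (cong ((P.a m′ ≤ᵇ L) ∧_) (≤ᵇ-false (past (proj₁ (proj₂ vm′+1)) visited)))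
                 (∧-zeroʳ _))
    where
      m′<Mn = ℕP.<-trans m′<m m<Mn
      vm′+1 = first-visit-of (suc m′) (s≤s z≤n) m′<Mn
      visited : proj₁ vm′+1 ≤ L
      visited = reached⇒visited (proj₂ vm′+1) 1≤L (subst (+ suc m′ ℤ.≤_) (sym RL≡m) (+≤+ m′<m))
      past : ∀ {y} → 1 ≤ y → y ≤ L → ¬ L ≤ ℕ.pred y
      past {suc y} _ y<L L≤y = ℕP.<⇒≱ y<L L≤y

  block-search : ∀ L → 1 ≤ L → R L ℤ.< M → findFirst (InBlock L) (Mn ∸ 1) ≡ just ∣ R L ∣
  block-search L 1≤L RL<M =
    findFirst-least (InBlock L) (Mn ∸ 1) m (in-own-block L m 1≤L 1≤m m<Mn (sym +m≡R)) 1≤m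
      (ℕP.∸-monoˡ-≤ 1 m<Mn) (λ m′ 1≤m′ m′<m → not-in-lower-block L m m′ 1≤L 1≤m′ m′<m m<Mn (sym +m≡R))
    where
      m = ∣ R L ∣
      +m≡R : + m ≡ R L
      +m≡R = ℤP.0≤i⇒+∣i∣≡i (ℤP.≤-trans (+≤+ z≤n) (R≥1 L))
      1≤m : 1 ≤ m
      1≤m = ℤP.drop‿+≤+ (subst (+ 1 ℤ.≤_) (sym +m≡R) (R≥1 L))
      m<Mn : m < Mn
      m<Mn = ℤP.drop‿+<+ (subst₂ ℤ._<_ (sym +m≡R) (sym +Mn≡M) RL<M)

  topVisit : Σ ℕ (FirstVisit Mn)
  topVisit = first-visit-of Mn 1≤Mn ℕP.≤-refl

  T≡pitman : ∀ l → 1 ≤ l → l ≤ N → P.T l ≡ + 2 * R l - s l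
  T≡pitman (suc l) _ l<N with topVisit | proj₁ topVisit ℕ.≤? suc l
  ... | x , vM | yes x≤L
    rewrite a≡first-visit Mn 1≤Mn ℕP.≤-refl vM | ≤ᵇ-true x≤L =
      cong (λ r → + 2 * r - s (suc l))
        (ℤP.≤-antisym (subst (ℤ._≤ R (suc l)) +Mn≡M (visit-reached vM x≤L)) (R-mono l<N))
  ... | x , vM | no x≰L
    rewrite a≡first-visit Mn 1≤Mn ℕP.≤-refl vM | ≤ᵇ-false x≰L
          | block-search (suc l) (s≤s z≤n) (subst (R (suc l) ℤ.<_) +Mn≡M
              (visit-not-reached vM (s≤s z≤n) (ℕP.≰⇒> x≰L))) =
      cong (λ r → + 2 * r - s (suc l)) (ℤP.0≤i⇒+∣i∣≡i (ℤP.≤-trans (+≤+ z≤n) (R≥1 (suc l))))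

  Φ : ℕ → ℤ
  Φ = at (Φ₁ n S)

  Φ0 : Φ 0 ≡ + 0
  Φ0 = at-tabulate (suc N) P.T 0 (s≤s z≤n)

  Φ₁-is-Pitman : ∀ l → 1 ≤ l → l ≤ N → Φ l ≡ + 2 * R l - s l
  Φ₁-is-Pitman l 1≤l l≤N = trans (at-tabulate (suc N) P.T l (s≤s l≤N)) (T≡pitman l 1≤l l≤N)

  -- Φ₁ S is a ±1 path with Φ₁ S ≥ R ≥ 1 after time 0.
  Φ₁-in-B′ : B′ n (Φ₁ n S)
  Φ₁-in-B′ = unit-steps , Φ0 , positive
    where
      unit-steps : ∀ i → i < N → ∣ Φ (suc i) - Φ i ∣ ≡ 1
      unit-steps zero    1≤N′ rewrite Φ₁-is-Pitman 1 ℕP.≤-refl 1≤N′ | Φ0 | s1 = refl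
      unit-steps (suc i) i<N
        rewrite Φ₁-is-Pitman (suc (suc i)) (s≤s z≤n) i<N
              | Φ₁-is-Pitman (suc i) (s≤s z≤n) (ℕP.<⇒≤ i<N) =
        pitman-step (s≤R (suc i)) (step (suc i) i<N)
      positive : ∀ i → 1 ≤ i → i ≤ N → + 0 ℤ.< Φ i
      positive i 1≤i i≤N rewrite Φ₁-is-Pitman i 1≤i i≤N =
        ℤP.suc[i]≤j⇒i<j (ℤP.≤-trans (R≥1 i) (reflect-above (s≤R i)))

  future-min : ∀ d l → l ℕ.+ d ≡ N → 1 ≤ l → windowMin Φ l d ⊓ M ≡ R l
  future-min zero l l+0≡N 1≤l rewrite ℕP.+-identityʳ l | l+0≡N | Φ₁-is-Pitman N 1≤N ℕP.≤-refl =
    ℤP.i≥j⇒i⊓j≡j (reflect-above (s≤R N))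
  future-min (suc d) l l+d+1≡N 1≤l = begin
    (Φ l ⊓ windowMin Φ (suc l) d) ⊓ M     ≡⟨ ℤP.⊓-assoc (Φ l) _ M ⟩
    Φ l ⊓ (windowMin Φ (suc l) d ⊓ M)     ≡⟨ cong (Φ l ⊓_) (future-min d (suc l) (trans (sym (ℕP.+-suc l d)) l+d+1≡N) (s≤s z≤n)) ⟩
    Φ l ⊓ R (suc l)                       ≡⟨ cong (_⊓ R (suc l)) (Φ₁-is-Pitman l 1≤l (ℕP.<⇒≤ l<N)) ⟩
    (+ 2 * R l - s l) ⊓ (R l ⊔ s (suc l))  ≡⟨ pitman-future-min (s≤R l) (step l l<N) ⟩
    R l                                   ∎
    where
      open ≡-Reasoning
      l<N : l < N
      l<N = subst (l <_) l+d+1≡N (subst (_≤ l ℕ.+ suc d) (ℕP.+-comm l 1) (ℕP.+-monoʳ-≤ l (s≤s z≤n)))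

  -- Hence S is determined by its transform and its maximum:  S = 2R − Φ₁ S.
  recover : ∀ l → 1 ≤ l → l ≤ N → s l ≡ + 2 * (windowMin Φ l (N ∸ l) ⊓ M) - Φ l
  recover l 1≤l l≤N rewrite future-min (N ∸ l) l (ℕP.m+[n∸m]≡n l≤N) 1≤l | Φ₁-is-Pitman l 1≤l l≤N =
    double-reflection (R l) (s l)
    where double-reflection : ∀ r x → x ≡ + 2 * r - (+ 2 * r - x)
          double-reflection = solve-∀

  -- For a path returning to 0 the transform ends at 2M, which determines M.
  Φ-end : s N ≡ + 0 → Φ N ≡ + 2 * M
  Φ-end sN≡0 = trans (Φ₁-is-Pitman N 1≤N ℕP.≤-refl)
                 (trans (cong (λ z → + 2 * M - z) sN≡0) (ℤP.+-identityʳ (+ 2 * M)))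

-- Φ₁ is injective on A′ₙ: both paths have the same maximum M, read off from the
-- endpoint of the common transform, and are then recovered by `Walk.recover`.
Φ₁-injective : ∀ n → 1 ≤ n → (S S′ : Path n) → A′ n S → A′ n S′ → Φ₁ n S ≡ Φ₁ n S′ → S ≡ S′
Φ₁-injective n 1≤n S S′ (steps , s0 , s1>0 , sN) (steps′ , s0′ , s1>0′ , sN′) same-image =
  at-ext S S′ same-at
  where
    module W  = Walk n 1≤n S  steps  s0  s1>0
    module W′ = Walk n 1≤n S′ steps′ s0′ s1>0′
    same-max : W.M ≡ W′.M
    same-max = ℤP.*-cancelˡ-≡ (+ 2) W.M W′.M
      (trans (sym (W.Φ-end sN)) (trans (cong (λ v → at v W.N) same-image) (W′.Φ-end sN′)))
    rebuild : Path n → ℤ → ℕ → ℤ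
    rebuild v m i = + 2 * (windowMin (at v) i (W.N ∸ i) ⊓ m) - at v i
    same-at : ∀ i → i < suc W.N → at S i ≡ at S′ i
    same-at zero    _       = trans s0 (sym s0′)
    same-at (suc i) (s≤s i<N) = begin
      at S (suc i)                    ≡⟨ W.recover (suc i) (s≤s z≤n) i<N ⟩
      rebuild (Φ₁ n S) W.M (suc i)    ≡⟨ cong₂ (λ v m → rebuild v m (suc i)) same-image same-max ⟩
      rebuild (Φ₁ n S′) W′.M (suc i)  ≡⟨ sym (W′.recover (suc i) (s≤s z≤n) i<N) ⟩
      at S′ (suc i)                   ∎
      where open ≡-Reasoning

-- The preimage of a path T ∈ B′ₙ: T_{2n} = 2K with K ≥ 1, and the inverse
-- transform S = 2Q − T of the capped future minimum
--   Q_l = min (T_l, …, T_{2n}, K)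
-- lies in A′ₙ, has running maximum Q, and hence is mapped back to T.
module Preimage (n : ℕ) (1≤n : 1 ≤ n) (T : Path n) (hB : B′ n T) where

  N : ℕ
  N = 2 ℕ.* n

  t : ℕ → ℤ
  t = at T

  1≤N : 1 ≤ N
  1≤N = ℕP.≤-trans 1≤n (ℕP.m≤m+n n _)

  step : ∀ i → i < N → Step (t i) (t (suc i))
  step i i<N = unit⇒Step (t i) (t (suc i)) (proj₁ hB i i<N)

  t0 : t 0 ≡ + 0
  t0 = proj₁ (proj₂ hB)

  positive : ∀ i → 1 ≤ i → i ≤ N → + 0 ℤ.< t i
  positive = proj₂ (proj₂ hB)

  t1 : t 1 ≡ + 1
  t1 with step 0 1≤N
  ... | inj₁ e = trans e (cong (λ z → + 1 + z) t0)
  ... | inj₂ e = ⊥-elim (ℤP.<-asym (positive 1 ℕP.≤-refl 1≤N)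
          (subst (t 1 ℤ.<_) (trans (sym e) t0) (x<1+x (t 1))))

  parity : ∀ i → i ≤ N → Σ ℤ λ k → t i ≡ + i + + 2 * k
  parity zero    _   = + 0 , t0
  parity (suc i) i<N with parity i (ℕP.<⇒≤ i<N) | step i i<N
  ... | k , ti≡ | inj₁ up = k , trans up (trans (cong (λ z → + 1 + z) ti≡) (shift (+ i) k))
    where shift : ∀ a k → + 1 + (a + + 2 * k) ≡ (+ 1 + a) + + 2 * k
          shift = solve-∀
  ... | k , ti≡ | inj₂ down = k - + 1 ,
    trans (unshift (t (suc i))) (trans (cong (_- + 1) (trans (sym down) ti≡)) (shift (+ i) k))
    where unshift : ∀ x → x ≡ (+ 1 + x) - + 1
          unshift = solve-∀
          shift : ∀ a k → (a + + 2 * k) - + 1 ≡ (+ 1 + a) + + 2 * (k - + 1)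
          shift = solve-∀

  K : ℤ
  K = + n + proj₁ (parity N ℕP.≤-refl)

  t-end : t N ≡ + 2 * K
  t-end = trans (proj₂ (parity N ℕP.≤-refl)) (trans (cong (_+ + 2 * k) (ℤP.pos-* 2 n)) (factor (+ n) k))
    where k = proj₁ (parity N ℕP.≤-refl)
          factor : ∀ a k → + 2 * a + + 2 * k ≡ + 2 * (a + k)
          factor = solve-∀

  K≥1 : + 1 ℤ.≤ K
  K≥1 with + 1 ℤ.≤? K
  ... | yes 1≤K = 1≤K
  ... | no 1≰K = ⊥-elim (ℤP.<⇒≱ (subst (+ 0 ℤ.<_) t-end (positive N 1≤N ℕP.≤-refl))
                    (subst (ℤ._≤ + 0) (double K) (ℤP.+-mono-≤ K≤0 K≤0)))
    where K≤0 : K ℤ.≤ + 0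
          K≤0 = <1+⇒≤ (ℤP.≰⇒> 1≰K)
          double : ∀ k → k + k ≡ + 2 * k
          double = solve-∀

  K≤2K : K ℤ.≤ + 2 * K
  K≤2K = subst (K ℤ.≤_) (ℤP.+-identityʳ _) (reflect-above {+ 0} {K} (ℤP.≤-trans (+≤+ z≤n) K≥1))

  Q : ℕ → ℤ
  Q l = windowMin t l (N ∸ l) ⊓ K

  Q-step : ∀ l → l < N → Q l ≡ t l ⊓ Q (suc l)
  Q-step l l<N = trans (cong (λ d → windowMin t l d ⊓ K) (ℕP.+-∸-assoc 1 l<N)) (ℤP.⊓-assoc (t l) _ K)

  Q-end : Q N ≡ K
  Q-end rewrite ℕP.n∸n≡0 N | t-end = ℤP.i≥j⇒i⊓j≡j K≤2K

  Q≤t : ∀ l → l ≤ N → Q l ℤ.≤ t l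
  Q≤t l l≤N with ℕP.m≤n⇒m<n∨m≡n l≤N
  ... | inj₁ l<N = subst (ℤ._≤ t l) (sym (Q-step l l<N)) (ℤP.i⊓j≤i (t l) _)
  ... | inj₂ refl = subst₂ ℤ._≤_ (sym Q-end) (sym t-end) K≤2K

  Q≥1 : ∀ l → 1 ≤ l → l ≤ N → + 1 ℤ.≤ Q l
  Q≥1 l 1≤l l≤N = ℤP.⊓-glb (windowMin-glb t (+ 1) l (N ∸ l)
      (λ j l≤j j≤ → ℤP.i<j⇒suc[i]≤j (positive j (ℕP.≤-trans 1≤l l≤j) (subst (j ≤_) (ℕP.m+[n∸m]≡n l≤N) j≤))))
    K≥1

  Q1 : Q 1 ≡ + 1
  Q1 = ℤP.≤-antisym (subst (Q 1 ℤ.≤_) t1 (Q≤t 1 1≤N)) (Q≥1 1 ℕP.≤-refl 1≤N)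

  u : ℕ → ℤ
  u zero    = + 0
  u (suc l) = + 2 * Q (suc l) - t (suc l)

  preimage : Path n
  preimage = tabulate (λ i → u (toℕ i))

  preimage-at : ∀ i → i ≤ N → at preimage i ≡ u i
  preimage-at i i≤N = at-tabulate (suc N) u i (s≤s i≤N)

  u-formula : ∀ l → 1 ≤ l → u l ≡ + 2 * Q l - t l
  u-formula (suc l) _ = refl

  u1 : u 1 ≡ + 1
  u1 rewrite Q1 | t1 = refl

  u-end : u N ≡ + 0
  u-end = trans (u-formula N 1≤N) (trans (cong₂ (λ q x → + 2 * q - x) Q-end t-end) (cancel K))
    where cancel : ∀ k → + 2 * k - + 2 * k ≡ + 0
          cancel = solve-∀

  preimage-in-A′ : A′ n preimage
  preimage-in-A′ = unit-steps , preimage-at 0 z≤n ,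
    subst (+ 0 ℤ.<_) (sym (trans (preimage-at 1 1≤N) u1)) (+<+ (s≤s z≤n)) ,
    trans (preimage-at N ℕP.≤-refl) u-end
    where
      unit-steps : ∀ i → i < N → ∣ at preimage (suc i) - at preimage i ∣ ≡ 1
      unit-steps zero    1≤N′ rewrite preimage-at 1 1≤N′ | preimage-at 0 z≤n | u1 = refl
      unit-steps (suc i) i<N rewrite preimage-at (suc (suc i)) i<N | preimage-at (suc i) (ℕP.<⇒≤ i<N) =
        inverse-step (Q-step (suc i) i<N) (Q≤t (suc (suc i)) i<N) (step (suc i) i<N)

  module W = Walk n 1≤n preimage (proj₁ preimage-in-A′) (proj₁ (proj₂ preimage-in-A′))
                                 (proj₁ (proj₂ (proj₂ preimage-in-A′)))

  running-max≡Q : ∀ l → 1 ≤ l → l ≤ N → W.R l ≡ Q l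
  running-max≡Q (suc zero) _ 1≤N′ rewrite preimage-at 1 1≤N′ | u1 | Q1 = refl
  running-max≡Q (suc (suc i)) _ i<N
    rewrite running-max≡Q (suc i) (s≤s z≤n) (ℕP.<⇒≤ i<N) | preimage-at (suc (suc i)) i<N =
    inverse-running-max (Q-step (suc i) i<N) (Q≤t (suc (suc i)) i<N) (step (suc i) i<N)

  Φ₁-preimage : Φ₁ n preimage ≡ T
  Φ₁-preimage = at-ext _ _ same-at
    where
      undo : ∀ q x → + 2 * q - (+ 2 * q - x) ≡ x
      undo = solve-∀
      same-at : ∀ i → i < suc N → W.Φ i ≡ t i
      same-at zero    _         = trans W.Φ0 (sym t0)
      same-at (suc i) (s≤s i<N) = begin
        W.Φ (suc i)                                ≡⟨ W.Φ₁-is-Pitman (suc i) (s≤s z≤n) i<N ⟩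
        + 2 * W.R (suc i) - at preimage (suc i)   ≡⟨ cong₂ (λ r x → + 2 * r - x)
                                                        (running-max≡Q (suc i) (s≤s z≤n) i<N)
                                                        (preimage-at (suc i) i<N) ⟩
        + 2 * Q (suc i) - u (suc i)               ≡⟨ undo (Q (suc i)) (t (suc i)) ⟩
        t (suc i)                                 ∎
        where open ≡-Reasoning

theorem1 : (n : ℕ) → 1 ≤ n →
    ((S : Path n) → A′ n S → B′ n (Φ₁ n S)) ×
    ((S S′ : Path n) → A′ n S → A′ n S′ → Φ₁ n S ≡ Φ₁ n S′ → S ≡ S′) ×
    ((T : Path n) → B′ n T → ∃ (λ S → A′ n S × Φ₁ n S ≡ T))
theorem1 n 1≤n = into-B′ , Φ₁-injective n 1≤n , onto
  where
    into-B′ : (S : Path n) → A′ n S → B′ n (Φ₁ n S)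
    into-B′ S (steps , s0 , s1>0 , _) = Walk.Φ₁-in-B′ n 1≤n S steps s0 s1>0
    onto : (T : Path n) → B′ n T → ∃ (λ S → A′ n S × Φ₁ n S ≡ T)
    onto T hB = preimage , preimage-in-A′ , Φ₁-preimage
      where open Preimage n 1≤n T hB
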